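{- Let $K$ be an odd integer and let $m>1$ be an integer. Then: (1) if $m>3$, then $\omega_K(m)=4$ if and only if $\alpha_K(m)\equiv\pm1\pmod 4$; (2) $\omega_K(m)=2$ if and only if $4\mid\pi_K(m)$ and $2\mid\alpha_K(m)$; (3) $\omega_K(m)=1$ if and only if $4\nmid\pi_K(m)$.
   Context: For an integer $K$, the $K$-Fibonacci sequence is $F_{K,0}=0$, $F_{K,1}=1$, $F_{K,n}=KF_{K,n-1}+F_{K,n-2}$ for $n\ge2$. For an integer $m\ge 2$, $\pi_K(m)$ is the least positive period of $(F_{K,n}\bmod m)$, $\alpha_K(m)$ is the least positive index $n$ with $m\mid F_{K,n}$, and $\omega_K(m)$ is the number of indices $0\le n<\pi_K(m)$ with $m\mid F_{K,n}$. -}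

module Defs where

open import Data.Nat as ℕ using (ℕ; zero; suc; _<_; _≤_)
open import Data.Nat.Divisibility as ℕD using (_∣?_)
open import Data.Integer as ℤ using (ℤ; ∣_∣)
open import Data.List using (List; length; filter; upTo)
open import Relation.Nullary using (¬_)
open import Data.Product using (_×_)

F : ℤ → ℕ → ℤ
F K zero = ℤ.0ℤ
F K (suc zero) = ℤ.1ℤ
F K (suc (suc n)) = K ℤ.* F K (suc n) ℤ.+ F K n

OddInt : ℤ → Set
OddInt K = ¬ (2 ℕD.∣ ∣ K ∣)

DivF : ℤ → ℕ → ℕ → Set
DivF K m n = m ℕD.∣ ∣ F K n ∣

IsPeriod : ℤ → ℕ → ℕ → Set
IsPeriod K m p = 0 < p × (∀ n → m ℕD.∣ ∣ F K (n ℕ.+ p) ℤ.- F K n ∣)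

IsPi : ℤ → ℕ → ℕ → Set
IsPi K m p = IsPeriod K m p × (∀ q → IsPeriod K m q → p ≤ q)

IsAlpha : ℤ → ℕ → ℕ → Set
IsAlpha K m a = 0 < a × DivF K m a × (∀ b → 0 < b → b < a → ¬ DivF K m b)

countZeros : ℤ → ℕ → ℕ → ℕ
countZeros K m p = length (filter (λ n → m ∣? ∣ F K n ∣) (upTo p))

{-# OPTIONS --safe #-}
-- Let a = α_K(m) and c = F_{K,a-1}. Since m ∣ F_{K,a}, the addition formula gives
-- F_{n+a} ≡ c F_n (mod m), and Cassini's identity gives c² ≡ (-1)^a, so c is a unit with
-- c⁴ ≡ 1. Hence the zeros of F mod m are exactly the multiples of a, π = k a for the
-- multiplicative order k ∈ {1, 2, 4} of c, and ω = k. If a is odd then c² ≡ -1, so k = 4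
-- unless m ∣ 2, and modulo 2 the order is 1; if a is even then c² ≡ 1 and k ≤ 2. Finally,
-- for odd K, k = 1 is impossible when 4 ∣ a: writing a = 2b with b even, c ≡ 1 would give
-- m ∣ F_b L_b and m ∣ F_b L_{b-1}, and consecutive Lucas numbers are coprime, so m ∣ F_b.
module Submission where

open import Defs
open import Data.Nat using (ℕ; zero; suc; _<_; _%_; z≤n; s≤s)
import Data.Nat as ℕ
import Data.Nat.Properties as ℕ
open import Data.Nat.Divisibility
  using (_∣_; divides; _∣?_; _∣0; ∣-refl; ∣m∣n⇒∣m+n; m%n≡0⇒n∣m; >⇒∤)
open import Data.Nat.DivMod using (m%n<n; m≡m%n+[m/n]*n)
open import Data.Integer using (ℤ)
import Data.Integer.Properties as ℤ
import Data.Integer.DivMod as ℤ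
import Data.Integer.Divisibility.Signed as Signed
open import Data.Integer.Tactic.RingSolver using (solve-∀)
open import Data.Product using (_×_; _,_; proj₁; proj₂; ∃-syntax; ∃₂)
open import Data.Sum using (_⊎_; inj₁; inj₂)
open import Function.Base using (_∘_)
open import Function.Bundles using (_⇔_; mk⇔; module Equivalence)
import Function.Properties.Equivalence as ⇔
open import Level using (0ℓ)
open import Relation.Binary.Bundles using (Setoid)
open import Relation.Binary.PropositionalEquality
  using (_≡_; refl; sym; trans; cong; cong₂; subst; module ≡-Reasoning)
import Relation.Binary.Reasoning.Setoid
open import Relation.Nullary using (¬_; yes; no; contradiction)
open import Relation.Nullary.Decidable using (from-no; decidable-stable)

module _ where
  open import Data.Nat using (_+_; _*_; _≤_; >-nonZero)
  open import Data.Nat.Properties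
  open import Data.Nat.Divisibility using (∣n∣m%n⇒∣m; %-presˡ-∣; m∣m*n; *-monoʳ-∣)
  open import Data.List using ([_]; _++_; length; filter; upTo)
  open import Data.List.Properties
    using (upTo-∷ʳ; filter-++; length-++; filter-accept; filter-reject)
  open import Relation.Unary using (Decidable)

  odd-residues-mod-4 : ∀ r → r < 4 → (r ≡ 1 ⊎ r ≡ 3) ⇔ (¬ 2 ∣ r)
  odd-residues-mod-4 0 _ = mk⇔ (λ { (inj₁ ()) ; (inj₂ ()) }) (λ 2∤0 → contradiction (2 ∣0) 2∤0)
  odd-residues-mod-4 1 _ = mk⇔ (λ _ → from-no (2 ∣? 1)) (λ _ → inj₁ refl)
  odd-residues-mod-4 2 _ = mk⇔ (λ { (inj₁ ()) ; (inj₂ ()) }) (λ 2∤2 → contradiction ∣-refl 2∤2)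
  odd-residues-mod-4 3 _ = mk⇔ (λ _ → from-no (2 ∣? 3)) (λ _ → inj₂ refl)
  odd-residues-mod-4 (suc (suc (suc (suc _)))) (s≤s (s≤s (s≤s (s≤s ()))))

  n%4≡1⊎n%4≡3⇔2∤n : ∀ n → (n % 4 ≡ 1 ⊎ n % 4 ≡ 3) ⇔ (¬ 2 ∣ n)
  n%4≡1⊎n%4≡3⇔2∤n n = ⇔.trans (odd-residues-mod-4 (n % 4) (m%n<n n 4)) (mk⇔
    (λ 2∤n%4 2∣n → 2∤n%4 (%-presˡ-∣ 2∣n 2∣4))
    (λ 2∤n 2∣n%4 → 2∤n (∣n∣m%n⇒∣m 2∣4 2∣n%4)))
    where
    2∣4 : 2 ∣ 4
    2∣4 = divides 2 refl

  module _ {p} {P : ℕ → Set p} (P? : Decidable P) where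

    countBelow : ℕ → ℕ
    countBelow n = length (filter P? (upTo n))

    countBelow-suc : ∀ n → countBelow (suc n) ≡ countBelow n + length (filter P? [ n ])
    countBelow-suc n = begin
      length (filter P? (upTo (suc n)))               ≡⟨ cong (length ∘ filter P?) (upTo-∷ʳ n) ⟨
      length (filter P? (upTo n ++ [ n ]))            ≡⟨ cong length (filter-++ P? (upTo n) [ n ]) ⟩
      length (filter P? (upTo n) ++ filter P? [ n ])  ≡⟨ length-++ (filter P? (upTo n)) ⟩
      countBelow n + length (filter P? [ n ])         ∎
      where open ≡-Reasoning

    countBelow-accept : ∀ {n} → P n → countBelow (suc n) ≡ suc (countBelow n)
    countBelow-accept {n} Pn = begin
      countBelow (suc n)                          ≡⟨ countBelow-suc n ⟩
      countBelow n + length (filter P? [ n ])     ≡⟨ cong (λ xs → countBelow n + length xs) (filter-accept P? Pn) ⟩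
      countBelow n + 1                            ≡⟨ +-comm (countBelow n) 1 ⟩
      suc (countBelow n)                          ∎
      where open ≡-Reasoning

    countBelow-reject : ∀ {n} → ¬ P n → countBelow (suc n) ≡ countBelow n
    countBelow-reject {n} ¬Pn = begin
      countBelow (suc n)                          ≡⟨ countBelow-suc n ⟩
      countBelow n + length (filter P? [ n ])     ≡⟨ cong (λ xs → countBelow n + length xs) (filter-reject P? ¬Pn) ⟩
      countBelow n + 0                            ≡⟨ +-identityʳ (countBelow n) ⟩
      countBelow n                                ∎
      where open ≡-Reasoning

    module _ {a} (0<a : 0 < a) (P⇔a∣ : ∀ n → P n ⇔ a ∣ n) where

      c*a<j*a+a⇒c≤j : ∀ {c j} → c * a < j * a + a → c ≤ j
      c*a<j*a+a⇒c≤j {c} {j} c*a<j*a+a =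
        ≤-pred (*-cancelʳ-< a c (suc j) (subst (c * a <_) (+-comm (j * a) a) c*a<j*a+a))

      a∣n⇒c*a<n+a⇒c*a≤n : ∀ {c n} → a ∣ n → c * a < n + a → c * a ≤ n
      a∣n⇒c*a<n+a⇒c*a≤n {c} (divides j refl) = *-monoˡ-≤ a ∘ c*a<j*a+a⇒c≤j {c} {j}

      countBelow-ceiling : ∀ n → n ≤ countBelow n * a × countBelow n * a < n + a
      countBelow-ceiling zero = z≤n , 0<a
      countBelow-ceiling (suc n) with P? n | countBelow-ceiling n
      ... | yes Pn | n≤C*a , C*a<n+a rewrite countBelow-accept Pn =
        +-mono-≤ 0<a n≤C*a , s≤s (≤-trans (+-monoʳ-≤ a C*a≤n) (≤-reflexive (+-comm a n)))
        where
        C*a≤n : countBelow n * a ≤ n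
        C*a≤n = a∣n⇒c*a<n+a⇒c*a≤n {countBelow n} (Equivalence.to (P⇔a∣ n) Pn) C*a<n+a
      ... | no ¬Pn | n≤C*a , C*a<n+a rewrite countBelow-reject ¬Pn =
        ≤∧≢⇒< n≤C*a (¬Pn ∘ Equivalence.from (P⇔a∣ n) ∘ divides (countBelow n)) , m≤n⇒m≤1+n C*a<n+a

      countBelow-multiple : ∀ k → countBelow (k * a) ≡ k
      countBelow-multiple k = ≤-antisym
        (c*a<j*a+a⇒c≤j {countBelow (k * a)} (proj₂ (countBelow-ceiling (k * a))))
        (*-cancelʳ-≤ k (countBelow (k * a)) a {{>-nonZero 0<a}} (proj₁ (countBelow-ceiling (k * a))))

  -- The possible orders k of F_{K,α-1} modulo m, with what each forces on α = a.
  data OrderCase (a : ℕ) : ℕ → Set where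
    order-1 : ¬ 4 ∣ a → OrderCase a 1
    order-2 : 2 ∣ a → OrderCase a 2
    order-4 : ¬ 2 ∣ a → OrderCase a 4

  module _ {a : ℕ} where

    k≡1⇔4∤k*a : ∀ {k} → OrderCase a k → k ≡ 1 ⇔ (¬ 4 ∣ k * a)
    k≡1⇔4∤k*a (order-1 4∤a) = mk⇔ (λ _ → 4∤a ∘ subst (4 ∣_) (*-identityˡ a)) (λ _ → refl)
    k≡1⇔4∤k*a (order-2 2∣a) = mk⇔ (λ ()) (contradiction (*-monoʳ-∣ 2 2∣a))
    k≡1⇔4∤k*a (order-4 _)   = mk⇔ (λ ()) (contradiction (m∣m*n a))

    k≡2⇔4∣k*a×2∣a : ∀ {k} → OrderCase a k → k ≡ 2 ⇔ (4 ∣ k * a × 2 ∣ a)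
    k≡2⇔4∣k*a×2∣a (order-1 4∤a) =
      mk⇔ (λ ()) (λ (4∣1*a , _) → contradiction (subst (4 ∣_) (*-identityˡ a) 4∣1*a) 4∤a)
    k≡2⇔4∣k*a×2∣a (order-2 2∣a) = mk⇔ (λ _ → *-monoʳ-∣ 2 2∣a , 2∣a) (λ _ → refl)
    k≡2⇔4∣k*a×2∣a (order-4 2∤a) = mk⇔ (λ ()) (λ (_ , 2∣a) → contradiction 2∣a 2∤a)

    k≡4⇒2∤a : ∀ {k} → OrderCase a k → k ≡ 4 → ¬ 2 ∣ a
    k≡4⇒2∤a (order-4 2∤a) _ = 2∤a

    k≡4⇔a%4≡1⊎a%4≡3 : ∀ {k} → OrderCase a k → (¬ 2 ∣ a → k ≡ 4) →
                      k ≡ 4 ⇔ (a % 4 ≡ 1 ⊎ a % 4 ≡ 3)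
    k≡4⇔a%4≡1⊎a%4≡3 case 2∤a⇒k≡4 = mk⇔
      (Equivalence.from (n%4≡1⊎n%4≡3⇔2∤n a) ∘ k≡4⇒2∤a case)
      (2∤a⇒k≡4 ∘ Equivalence.to (n%4≡1⊎n%4≡3⇔2∤n a))

open import Data.Integer using (+_; -_; _+_; _-_; _*_; _^_; 0ℤ; 1ℤ; -1ℤ)

-1^[2+n]≡-1^n : ∀ n → -1ℤ ^ suc (suc n) ≡ -1ℤ ^ n
-1^[2+n]≡-1^n n = trans (sym (ℤ.*-assoc -1ℤ -1ℤ (-1ℤ ^ n))) (ℤ.*-identityˡ (-1ℤ ^ n))

-1^[j*2]≡1 : ∀ j → -1ℤ ^ (j ℕ.* 2) ≡ 1ℤ
-1^[j*2]≡1 zero    = refl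
-1^[j*2]≡1 (suc j) = trans (-1^[2+n]≡-1^n (j ℕ.* 2)) (-1^[j*2]≡1 j)

2∤n⇒-1^n≡-1 : ∀ n → ¬ 2 ∣ n → -1ℤ ^ n ≡ -1ℤ
2∤n⇒-1^n≡-1 zero          2∤0   = contradiction (2 ∣0) 2∤0
2∤n⇒-1^n≡-1 (suc zero)    _     = refl
2∤n⇒-1^n≡-1 (suc (suc n)) 2∤2+n = trans (-1^[2+n]≡-1^n n) (2∤n⇒-1^n≡-1 n (2∤2+n ∘ ∣m∣n⇒∣m+n ∣-refl))

-1^n*-1^n≡1 : ∀ n → -1ℤ ^ n * -1ℤ ^ n ≡ 1ℤ
-1^n*-1^n≡1 zero    = refl
-1^n*-1^n≡1 (suc n) = trans (identity (-1ℤ ^ n)) (-1^n*-1^n≡1 n)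
  where
  identity : ∀ s → (-1ℤ * s) * (-1ℤ * s) ≡ s * s
  identity = solve-∀

2∣i⊎2∣i-1 : ∀ i → + 2 Signed.∣ i ⊎ + 2 Signed.∣ i - 1ℤ
2∣i⊎2∣i-1 i with i ℤ.% + 2 | ℤ.n%d<d i (+ 2) | ℤ.a≡a%n+[a/n]*n i (+ 2)
... | 0           | _               | i≡ = inj₁ (Signed.divides (i ℤ./ + 2) (trans i≡ (ℤ.+-identityˡ _)))
... | 1           | _               | i≡ =
  inj₂ (Signed.divides (i ℤ./ + 2) (trans (cong (_- 1ℤ) i≡) (identity (i ℤ./ + 2))))
  where
  identity : ∀ q → (1ℤ + q * + 2) - 1ℤ ≡ q * + 2
  identity = solve-∀
... | suc (suc _) | s≤s (s≤s ())   | _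

odd⇒2∣i-1 : ∀ {i} → OddInt i → + 2 Signed.∣ i - 1ℤ
odd⇒2∣i-1 {i} 2∤i with 2∣i⊎2∣i-1 i
... | inj₁ 2∣i   = contradiction (Signed.∣⇒∣ᵤ 2∣i) 2∤i
... | inj₂ 2∣i-1 = 2∣i-1

module _ (K : ℤ) where

  F-addition : ∀ n k → F K (n ℕ.+ suc k) ≡ F K (suc k) * F K (suc n) + F K k * F K n
  F-addition zero          k = identity (F K (suc k)) (F K k)
    where
    identity : ∀ x y → x ≡ x * 1ℤ + y * 0ℤ
    identity = solve-∀
  F-addition (suc zero)    k = identity K (F K (suc k)) (F K k)
    where
    identity : ∀ K x y → K * x + y ≡ x * (K * 1ℤ + 0ℤ) + y * 1ℤ
    identity = solve-∀
  F-addition (suc (suc n)) k = trans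
    (cong₂ (λ u v → K * u + v) (F-addition (suc n) k) (F-addition n k))
    (identity K (F K (suc k)) (F K k) (F K n) (F K (suc n)))
    where
    identity : ∀ K x y u v →
      K * (x * (K * v + u) + y * v) + (x * v + y * u) ≡ x * (K * (K * v + u) + v) + y * (K * v + u)
    identity = solve-∀

  cassini : ∀ n → F K (suc (suc n)) * F K n - F K (suc n) * F K (suc n) ≡ -1ℤ ^ suc n
  cassini zero    = identity K
    where
    identity : ∀ K → (K * 1ℤ + 0ℤ) * 0ℤ - 1ℤ * 1ℤ ≡ -1ℤ * 1ℤ
    identity = solve-∀
  cassini (suc n) = trans (identity K (F K n) (F K (suc n))) (cong (-1ℤ *_) (cassini n))
    where
    identity : ∀ K u v →
      (K * (K * v + u) + v) * v - (K * v + u) * (K * v + u) ≡ -1ℤ * ((K * v + u) * u - v * v)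
    identity = solve-∀

  L : ℕ → ℤ
  L zero                = + 2
  L (suc zero)          = K
  L (suc (suc n))       = K * L (suc n) + L n

  L[1+n]≡F[2+n]+F[n] : ∀ n → L (suc n) ≡ F K (suc (suc n)) + F K n
  L[1+n]≡F[2+n]+F[n] zero          = identity K
    where
    identity : ∀ K → K ≡ (K * 1ℤ + 0ℤ) + 0ℤ
    identity = solve-∀
  L[1+n]≡F[2+n]+F[n] (suc zero)    = identity K
    where
    identity : ∀ K → K * K + + 2 ≡ (K * (K * 1ℤ + 0ℤ) + 1ℤ) + 1ℤ
    identity = solve-∀
  L[1+n]≡F[2+n]+F[n] (suc (suc n)) = trans
    (cong₂ (λ u v → K * u + v) (L[1+n]≡F[2+n]+F[n] (suc n)) (L[1+n]≡F[2+n]+F[n] n))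
    (identity K (F K n) (F K (suc n)))
    where
    identity : ∀ K u v →
      K * ((K * (K * v + u) + v) + v) + ((K * v + u) + u)
        ≡ (K * (K * (K * v + u) + v) + (K * v + u)) + (K * v + u)
    identity = solve-∀

  F[n+n]≡F[n]*L[n] : ∀ n → F K (n ℕ.+ n) ≡ F K n * L n
  F[n+n]≡F[n]*L[n] zero    = refl
  F[n+n]≡F[n]*L[n] (suc n) = begin
    F K (suc n ℕ.+ suc n)                   ≡⟨ F-addition (suc n) n ⟩
    x * F K (suc (suc n)) + F K n * x       ≡⟨ cong (λ w → x * F K (suc (suc n)) + w) (ℤ.*-comm (F K n) x) ⟩
    x * F K (suc (suc n)) + x * F K n       ≡⟨ ℤ.*-distribˡ-+ x (F K (suc (suc n))) (F K n) ⟨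
    x * (F K (suc (suc n)) + F K n)         ≡⟨ cong (x *_) (L[1+n]≡F[2+n]+F[n] n) ⟨
    x * L (suc n)                           ∎
    where
    open ≡-Reasoning
    x = F K (suc n)

  F[n+1+n]≡F[1+n]*L[n]+-1^[1+n] : ∀ n → F K (n ℕ.+ suc n) ≡ F K (suc n) * L n + -1ℤ ^ suc n
  F[n+1+n]≡F[1+n]*L[n]+-1^[1+n] zero    = refl
  F[n+1+n]≡F[1+n]*L[n]+-1^[1+n] (suc n) = begin
    F K (suc n ℕ.+ suc (suc n))                     ≡⟨ F-addition (suc n) (suc n) ⟩
    x * x + y * y                                   ≡⟨ identity x y z ⟩
    x * (x + z) + -1ℤ * (x * z - y * y)
      ≡⟨ cong₂ (λ l s → x * l + -1ℤ * s) (sym (L[1+n]≡F[2+n]+F[n] n)) (cassini n) ⟩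
    x * L (suc n) + -1ℤ ^ suc (suc n)               ∎
    where
    open ≡-Reasoning
    x = F K (suc (suc n))
    y = F K (suc n)
    z = F K n
    identity : ∀ x y z → x * x + y * y ≡ x * (x + z) + -1ℤ * (x * z - y * y)
    identity = solve-∀

  L-coprime : OddInt K → ∀ n → ∃₂ λ u v → u * L (suc n) + v * L n ≡ 1ℤ
  L-coprime K-odd zero with odd⇒2∣i-1 {K} K-odd
  ... | Signed.divides t K-1≡t*2 = 1ℤ , - t , (begin
    1ℤ * K + - t * + 2      ≡⟨ identity K t ⟩
    K - t * + 2             ≡⟨ cong (λ w → K - w) K-1≡t*2 ⟨
    K - (K - 1ℤ)            ≡⟨ identity′ K ⟩
    1ℤ                      ∎)
    where
    open ≡-Reasoning
    identity : ∀ K t → 1ℤ * K + - t * + 2 ≡ K - t * + 2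
    identity = solve-∀
    identity′ : ∀ K → K - (K - 1ℤ) ≡ 1ℤ
    identity′ = solve-∀
  L-coprime K-odd (suc n) with L-coprime K-odd n
  ... | u , v , uL[1+n]+vL[n]≡1 = v , u - v * K , trans (identity K (L n) (L (suc n)) u v) uL[1+n]+vL[n]≡1
    where
    identity : ∀ K x y u v → v * (K * y + x) + (u - v * K) * y ≡ u * y + v * x
    identity = solve-∀

module Congruence (m : ℕ) where
  open import Data.Integer using (∣_∣)

  infix 4 _≈_
  record _≈_ (x y : ℤ) : Set where
    constructor mk≈
    field m∣x-y : + m Signed.∣ x - y

  ≈-reflexive : ∀ {x y} → x ≡ y → x ≈ y
  ≈-reflexive {x} refl = mk≈ (Signed.divides 0ℤ (ℤ.+-inverseʳ x))

  ≈-refl : ∀ {x} → x ≈ x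
  ≈-refl = ≈-reflexive refl

  ≈-sym : ∀ {x y} → x ≈ y → y ≈ x
  ≈-sym {x} {y} (mk≈ m∣x-y) = mk≈ (subst (+ m Signed.∣_) (identity x y) (Signed.∣m⇒∣-m m∣x-y))
    where
    identity : ∀ x y → - (x - y) ≡ y - x
    identity = solve-∀

  ≈-trans : ∀ {x y z} → x ≈ y → y ≈ z → x ≈ z
  ≈-trans {x} {y} {z} (mk≈ m∣x-y) (mk≈ m∣y-z) =
    mk≈ (subst (+ m Signed.∣_) (identity x y z) (Signed.∣m∣n⇒∣m+n m∣x-y m∣y-z))
    where
    identity : ∀ x y z → (x - y) + (y - z) ≡ x - z
    identity = solve-∀

  ≈-setoid : Setoid 0ℓ 0ℓ
  ≈-setoid = record
    { Carrier       = ℤ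
    ; _≈_           = _≈_
    ; isEquivalence = record { refl = ≈-refl ; sym = ≈-sym ; trans = ≈-trans }
    }

  module ≈-Reasoning = Relation.Binary.Reasoning.Setoid ≈-setoid

  +-cong : ∀ {x y u v} → x ≈ y → u ≈ v → x + u ≈ y + v
  +-cong {x} {y} {u} {v} (mk≈ m∣x-y) (mk≈ m∣u-v) =
    mk≈ (subst (+ m Signed.∣_) (identity x y u v) (Signed.∣m∣n⇒∣m+n m∣x-y m∣u-v))
    where
    identity : ∀ x y u v → (x - y) + (u - v) ≡ (x + u) - (y + v)
    identity = solve-∀

  -‿cong : ∀ {x y} → x ≈ y → - x ≈ - y
  -‿cong {x} {y} (mk≈ m∣x-y) = mk≈ (subst (+ m Signed.∣_) (identity x y) (Signed.∣m⇒∣-m m∣x-y))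
    where
    identity : ∀ x y → - (x - y) ≡ - x - - y
    identity = solve-∀

  *-cong : ∀ {x y u v} → x ≈ y → u ≈ v → x * u ≈ y * v
  *-cong {x} {y} {u} {v} (mk≈ m∣x-y) (mk≈ m∣u-v) = mk≈ (subst (+ m Signed.∣_) (identity x y u v)
    (Signed.∣m∣n⇒∣m+n (Signed.∣m⇒∣m*n u m∣x-y) (Signed.∣n⇒∣m*n y m∣u-v)))
    where
    identity : ∀ x y u v → (x - y) * u + y * (u - v) ≡ x * u - y * v
    identity = solve-∀

  *-congˡ : ∀ z {x y} → x ≈ y → z * x ≈ z * y
  *-congˡ z = *-cong (≈-refl {z})

  *-congʳ : ∀ z {x y} → x ≈ y → x * z ≈ y * z
  *-congʳ z x≈y = *-cong x≈y (≈-refl {z})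

  ∣⇒≈ : ∀ {x y} → m ∣ ∣ x - y ∣ → x ≈ y
  ∣⇒≈ m∣x-y = mk≈ (Signed.∣ᵤ⇒∣ m∣x-y)

  ≈⇒∣ : ∀ {x y} → x ≈ y → m ∣ ∣ x - y ∣
  ≈⇒∣ (mk≈ m∣x-y) = Signed.∣⇒∣ᵤ m∣x-y

  ∣⇒≈0 : ∀ {x} → m ∣ ∣ x ∣ → x ≈ 0ℤ
  ∣⇒≈0 {x} m∣x = ∣⇒≈ (subst (λ y → m ∣ ∣ y ∣) (sym (ℤ.+-identityʳ x)) m∣x)

  ≈0⇒∣ : ∀ {x} → x ≈ 0ℤ → m ∣ ∣ x ∣
  ≈0⇒∣ {x} x≈0 = subst (λ y → m ∣ ∣ y ∣) (ℤ.+-identityʳ x) (≈⇒∣ x≈0)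

  1≈-1⇒m∣2 : 1ℤ ≈ -1ℤ → m ∣ 2
  1≈-1⇒m∣2 = ≈⇒∣

  *-cancel-unit : ∀ {u v x} → u * v ≈ 1ℤ → v * x ≈ 0ℤ → x ≈ 0ℤ
  *-cancel-unit {u} {v} {x} uv≈1 vx≈0 = begin
    x                ≡⟨ ℤ.*-identityˡ x ⟨
    1ℤ * x           ≈⟨ *-congʳ x uv≈1 ⟨
    (u * v) * x      ≡⟨ ℤ.*-assoc u v x ⟩
    u * (v * x)      ≈⟨ *-congˡ u vx≈0 ⟩
    u * 0ℤ           ≡⟨ ℤ.*-zeroʳ u ⟩
    0ℤ               ∎
    where open ≈-Reasoning

  coprime-cancel : ∀ {u v x y z} → u * y + v * z ≡ 1ℤ → x * y ≈ 0ℤ → x * z ≈ 0ℤ → x ≈ 0ℤ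
  coprime-cancel {u} {v} {x} {y} {z} bezout xy≈0 xz≈0 = begin
    x                          ≡⟨ ℤ.*-identityʳ x ⟨
    x * 1ℤ                     ≡⟨ cong (x *_) bezout ⟨
    x * (u * y + v * z)        ≡⟨ identity u v x y z ⟩
    u * (x * y) + v * (x * z)  ≈⟨ +-cong (*-congˡ u xy≈0) (*-congˡ v xz≈0) ⟩
    u * 0ℤ + v * 0ℤ            ≡⟨ identity₀ u v ⟩
    0ℤ                         ∎
    where
    open ≈-Reasoning
    identity : ∀ u v x y z → x * (u * y + v * z) ≡ u * (x * y) + v * (x * z)
    identity = solve-∀
    identity₀ : ∀ u v → u * 0ℤ + v * 0ℤ ≡ 0ℤ
    identity₀ = solve-∀

  m∣2⇒x*x≈1⇒x≈1 : m ∣ 2 → ∀ {x} → x * x ≈ 1ℤ → x ≈ 1ℤ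
  m∣2⇒x*x≈1⇒x≈1 m∣2 {x} (mk≈ m∣x*x-1) with 2∣i⊎2∣i-1 x
  ... | inj₂ 2∣x-1 = mk≈ (Signed.∣-trans (Signed.∣ᵤ⇒∣ m∣2) 2∣x-1)
  ... | inj₁ 2∣x   = mk≈ (subst (+ m Signed.∣_) (ℤ.*-identityʳ (x - 1ℤ)) (Signed.∣n⇒∣m*n (x - 1ℤ) m∣1))
    where
    m∣x*x : + m Signed.∣ x * x
    m∣x*x = Signed.∣-trans (Signed.∣ᵤ⇒∣ m∣2) (Signed.∣m⇒∣m*n x 2∣x)
    identity : ∀ x → x * x - (x * x - 1ℤ) ≡ 1ℤ
    identity = solve-∀
    m∣1 : + m Signed.∣ 1ℤ
    m∣1 = subst (+ m Signed.∣_) (identity x) (Signed.∣m∣n⇒∣m-n m∣x*x m∣x*x-1)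

  IsOrder : ℤ → ℕ → Set
  IsOrder x k = 0 < k × x ^ k ≈ 1ℤ × (∀ q → 0 < q → x ^ q ≈ 1ℤ → k ℕ.≤ q)

  order≡1⊎2⊎4 : ∀ {x} k → IsOrder x k → x ^ 4 ≈ 1ℤ → k ≡ 1 ⊎ k ≡ 2 ⊎ k ≡ 4
  order≡1⊎2⊎4 1 _ _ = inj₁ refl
  order≡1⊎2⊎4 2 _ _ = inj₂ (inj₁ refl)
  order≡1⊎2⊎4 {x} 3 (_ , x^3≈1 , least) x^4≈1 =
    contradiction (least 1 (s≤s z≤n) (≈-trans (*-congˡ x (≈-sym x^3≈1)) x^4≈1)) λ { (s≤s ()) }
  order≡1⊎2⊎4 4 _ _ = inj₂ (inj₂ refl)
  order≡1⊎2⊎4 (suc (suc (suc (suc (suc _))))) (_ , _ , least) x^4≈1 =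
    contradiction (least 4 (s≤s z≤n) x^4≈1) λ { (s≤s (s≤s (s≤s (s≤s ())))) }

module _ {m : ℕ} (K : ℤ) where
  open Congruence m

  F[1+n]≈0-by-halving : OddInt K → ∀ n → -1ℤ ^ suc n ≡ 1ℤ →
                        F K (suc n ℕ.+ suc n) ≈ 0ℤ → F K (n ℕ.+ suc n) ≈ 1ℤ → F K (suc n) ≈ 0ℤ
  F[1+n]≈0-by-halving K-odd n -1^b≡1 F[b+b]≈0 F[n+b]≈1 with L-coprime K K-odd n
  ... | u , v , bezout = coprime-cancel {u} {v} bezout F[b]*L[b]≈0 F[b]*L[n]≈0
    where
    open ≈-Reasoning
    F[b]*L[b]≈0 : F K (suc n) * L K (suc n) ≈ 0ℤ
    F[b]*L[b]≈0 = ≈-trans (≈-reflexive (sym (F[n+n]≡F[n]*L[n] K (suc n)))) F[b+b]≈0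
    F[b]*L[n]≈0 : F K (suc n) * L K n ≈ 0ℤ
    F[b]*L[n]≈0 = begin
      F K (suc n) * L K n                        ≡⟨ identity (F K (suc n) * L K n) ⟩
      (F K (suc n) * L K n + 1ℤ) - 1ℤ            ≡⟨ cong (λ s → (F K (suc n) * L K n + s) - 1ℤ) -1^b≡1 ⟨
      (F K (suc n) * L K n + -1ℤ ^ suc n) - 1ℤ   ≡⟨ cong (_- 1ℤ) (F[n+1+n]≡F[1+n]*L[n]+-1^[1+n] K n) ⟨
      F K (n ℕ.+ suc n) - 1ℤ                     ≈⟨ +-cong F[n+b]≈1 (≈-refl { - 1ℤ}) ⟩
      1ℤ - 1ℤ                                    ≡⟨⟩
      0ℤ                                         ∎
      where
      identity : ∀ x → x ≡ (x + 1ℤ) - 1ℤ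
      identity = solve-∀

module RankOfApparition (K : ℤ) (m a′ : ℕ) (α-def : IsAlpha K m (suc a′)) where
  open import Data.Integer using (∣_∣)
  open Congruence m
  open ≈-Reasoning

  α : ℕ
  α = suc a′

  c : ℤ
  c = F K a′

  minimal : ∀ b → 0 < b → b < α → ¬ DivF K m b
  minimal = proj₂ (proj₂ α-def)

  F[α]≈0 : F K α ≈ 0ℤ
  F[α]≈0 = ∣⇒≈0 (proj₁ (proj₂ α-def))

  F[1+α]≈c : F K (suc α) ≈ c
  F[1+α]≈c = begin
    F K (suc α)      ≡⟨⟩
    K * F K α + c    ≈⟨ +-cong (*-congˡ K F[α]≈0) (≈-refl {c}) ⟩
    K * 0ℤ + c       ≡⟨ cong (_+ c) (ℤ.*-zeroʳ K) ⟩
    0ℤ + c           ≡⟨ ℤ.+-identityˡ c ⟩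
    c                ∎

  F[n+α]≈c*F[n] : ∀ n → F K (n ℕ.+ α) ≈ c * F K n
  F[n+α]≈c*F[n] n = begin
    F K (n ℕ.+ α)                    ≡⟨ F-addition K n a′ ⟩
    F K α * F K (suc n) + c * F K n  ≈⟨ +-cong (*-congʳ (F K (suc n)) F[α]≈0) (≈-refl {c * F K n}) ⟩
    0ℤ * F K (suc n) + c * F K n     ≡⟨ ℤ.+-identityˡ (c * F K n) ⟩
    c * F K n                        ∎

  F[n+qα]≈c^q*F[n] : ∀ q n → F K (n ℕ.+ q ℕ.* α) ≈ c ^ q * F K n
  F[n+qα]≈c^q*F[n] zero    n = begin
    F K (n ℕ.+ 0)   ≡⟨ cong (F K) (ℕ.+-identityʳ n) ⟩
    F K n           ≡⟨ ℤ.*-identityˡ (F K n) ⟨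
    1ℤ * F K n      ∎
  F[n+qα]≈c^q*F[n] (suc q) n = begin
    F K (n ℕ.+ (α ℕ.+ q ℕ.* α))   ≡⟨ cong (λ i → F K (n ℕ.+ i)) (ℕ.+-comm α (q ℕ.* α)) ⟩
    F K (n ℕ.+ (q ℕ.* α ℕ.+ α))   ≡⟨ cong (F K) (ℕ.+-assoc n (q ℕ.* α) α) ⟨
    F K (n ℕ.+ q ℕ.* α ℕ.+ α)     ≈⟨ F[n+α]≈c*F[n] (n ℕ.+ q ℕ.* α) ⟩
    c * F K (n ℕ.+ q ℕ.* α)       ≈⟨ *-congˡ c (F[n+qα]≈c^q*F[n] q n) ⟩
    c * (c ^ q * F K n)           ≡⟨ ℤ.*-assoc c (c ^ q) (F K n) ⟨
    c ^ suc q * F K n             ∎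

  c^2≡c*c : c ^ 2 ≡ c * c
  c^2≡c*c = cong (c *_) (ℤ.^-identityʳ c)

  c^2≈-1^α : c ^ 2 ≈ -1ℤ ^ α
  c^2≈-1^α = begin
    c ^ 2                                 ≡⟨ c^2≡c*c ⟩
    c * c                                 ≡⟨ ℤ.+-identityʳ (c * c) ⟨
    c * c - 0ℤ * 0ℤ                       ≈⟨ +-cong (*-congʳ c F[1+α]≈c) (-‿cong (*-cong F[α]≈0 F[α]≈0)) ⟨
    F K (suc α) * c - F K α * F K α       ≡⟨ cassini K a′ ⟩
    -1ℤ ^ α                               ∎

  -- Opaque, since `with` normalises the terms it abstracts and this proof is large.
  opaque
    c^4≈1 : c ^ 4 ≈ 1ℤ
    c^4≈1 = begin
      c ^ 4                     ≡⟨ ℤ.^-distribˡ-+-* c 2 2 ⟩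
      c ^ 2 * c ^ 2             ≈⟨ *-cong c^2≈-1^α c^2≈-1^α ⟩
      -1ℤ ^ α * -1ℤ ^ α         ≡⟨ -1^n*-1^n≡1 α ⟩
      1ℤ                        ∎

  c^3*c≈1 : c ^ 3 * c ≈ 1ℤ
  c^3*c≈1 = ≈-trans (≈-reflexive (ℤ.*-comm (c ^ 3) c)) c^4≈1

  c^q*x≈0⇒x≈0 : ∀ q {x} → c ^ q * x ≈ 0ℤ → x ≈ 0ℤ
  c^q*x≈0⇒x≈0 zero    {x} 1*x≈0       = ≈-trans (≈-reflexive (sym (ℤ.*-identityˡ x))) 1*x≈0
  c^q*x≈0⇒x≈0 (suc q) {x} c^[1+q]*x≈0 = c^q*x≈0⇒x≈0 q (*-cancel-unit {c ^ 3} {c} c^3*c≈1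
    (≈-trans (≈-reflexive (sym (ℤ.*-assoc c (c ^ q) x))) c^[1+q]*x≈0))

  F[qα]≈0 : ∀ q → F K (q ℕ.* α) ≈ 0ℤ
  F[qα]≈0 q = begin
    F K (q ℕ.* α)     ≈⟨ F[n+qα]≈c^q*F[n] q 0 ⟩
    c ^ q * 0ℤ        ≡⟨ ℤ.*-zeroʳ (c ^ q) ⟩
    0ℤ                ∎

  F≈0⇒α∣ : ∀ {n} → F K n ≈ 0ℤ → α ∣ n
  F≈0⇒α∣ {n} F[n]≈0 with n % α ℕ.≟ 0
  ... | yes n%α≡0 = m%n≡0⇒n∣m n α n%α≡0
  ... | no  n%α≢0 = contradiction (≈0⇒∣ F[n%α]≈0) (minimal (n % α) (ℕ.n≢0⇒n>0 n%α≢0) (m%n<n n α))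
    where
    F[n%α]≈0 : F K (n % α) ≈ 0ℤ
    F[n%α]≈0 = c^q*x≈0⇒x≈0 (n ℕ./ α) (begin
      c ^ (n ℕ./ α) * F K (n % α)      ≈⟨ F[n+qα]≈c^q*F[n] (n ℕ./ α) (n % α) ⟨
      F K (n % α ℕ.+ n ℕ./ α ℕ.* α)    ≡⟨ cong (F K) (m≡m%n+[m/n]*n n α) ⟨
      F K n                            ≈⟨ F[n]≈0 ⟩
      0ℤ                               ∎)

  DivF⇔α∣ : ∀ n → DivF K m n ⇔ α ∣ n
  DivF⇔α∣ n = mk⇔ (F≈0⇒α∣ ∘ ∣⇒≈0) λ { (divides q refl) → ≈0⇒∣ (F[qα]≈0 q) }

  countZeros[k*α]≡k : ∀ k → countZeros K m (k ℕ.* α) ≡ k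
  countZeros[k*α]≡k = countBelow-multiple (λ n → m ∣? ∣ F K n ∣) (s≤s z≤n) DivF⇔α∣

  period⇒α∣ : ∀ {p} → IsPeriod K m p → α ∣ p
  period⇒α∣ (_ , m∣F[n+p]-F[n]) = F≈0⇒α∣ (∣⇒≈ (m∣F[n+p]-F[n] 0))

  period⇒c^k≈1 : ∀ k → IsPeriod K m (k ℕ.* α) → c ^ k ≈ 1ℤ
  period⇒c^k≈1 k (_ , m∣F[n+p]-F[n]) = begin
    c ^ k                    ≡⟨ ℤ.*-identityʳ (c ^ k) ⟨
    c ^ k * F K 1            ≈⟨ F[n+qα]≈c^q*F[n] k 1 ⟨
    F K (1 ℕ.+ k ℕ.* α)      ≈⟨ ∣⇒≈ (m∣F[n+p]-F[n] 1) ⟩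
    F K 1                    ∎

  c^k≈1⇒period : ∀ {k} → 0 < k → c ^ k ≈ 1ℤ → IsPeriod K m (k ℕ.* α)
  c^k≈1⇒period {suc k} _ c^k≈1 = s≤s z≤n , λ n → ≈⇒∣ (begin
    F K (n ℕ.+ suc k ℕ.* α)    ≈⟨ F[n+qα]≈c^q*F[n] (suc k) n ⟩
    c ^ suc k * F K n          ≈⟨ *-congʳ (F K n) c^k≈1 ⟩
    1ℤ * F K n                 ≡⟨ ℤ.*-identityˡ (F K n) ⟩
    F K n                      ∎)

  π≡order*α : ∀ {p} → IsPi K m p → ∃[ k ] p ≡ k ℕ.* α × IsOrder c k
  π≡order*α (period@(0<p , _) , least) with period⇒α∣ period
  ... | divides zero    refl = contradiction 0<p λ ()
  ... | divides (suc k) refl = suc k , refl , s≤s z≤n , period⇒c^k≈1 (suc k) period ,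
    λ q 0<q c^q≈1 → ℕ.*-cancelʳ-≤ (suc k) q α (least (q ℕ.* α) (c^k≈1⇒period 0<q c^q≈1))

  α-even⇒c^2≈1 : 2 ∣ α → c ^ 2 ≈ 1ℤ
  α-even⇒c^2≈1 (divides j α≡j*2) =
    ≈-trans c^2≈-1^α (≈-reflexive (trans (cong (-1ℤ ^_) α≡j*2) (-1^[j*2]≡1 j)))

  α-odd∧c^2≈1⇒m∣2 : ¬ 2 ∣ α → c ^ 2 ≈ 1ℤ → m ∣ 2
  α-odd∧c^2≈1⇒m∣2 2∤α c^2≈1 =
    1≈-1⇒m∣2 (≈-trans (≈-sym c^2≈1) (≈-trans c^2≈-1^α (≈-reflexive (2∤n⇒-1^n≡-1 α 2∤α))))

  α-odd∧2<m⇒c^2≉1 : ¬ 2 ∣ α → 2 < m → ¬ c ^ 2 ≈ 1ℤ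
  α-odd∧2<m⇒c^2≉1 2∤α 2<m = >⇒∤ 2<m ∘ α-odd∧c^2≈1⇒m∣2 2∤α

  4∣α⇒c≉1 : OddInt K → 4 ∣ α → ¬ c ≈ 1ℤ
  4∣α⇒c≉1 K-odd (divides (suc j) α≡[1+j]*4) c≈1 =
    minimal b (s≤s z≤n) (subst (b <_) b+b≡α (ℕ.m<m+n b (s≤s z≤n))) (≈0⇒∣ F[b]≈0)
    where
    n = suc (j ℕ.* 2)
    b = suc n
    b+b≡α : b ℕ.+ b ≡ α
    b+b≡α = trans (sym (ℕ.*-distribˡ-+ (suc j) 2 2)) (sym α≡[1+j]*4)
    F[b]≈0 : F K b ≈ 0ℤ
    F[b]≈0 = F[1+n]≈0-by-halving K K-odd n (-1^[j*2]≡1 (suc j))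
      (subst (λ i → F K i ≈ 0ℤ) (sym b+b≡α) F[α]≈0)
      (subst (λ i → F K i ≈ 1ℤ) (sym (ℕ.suc-injective b+b≡α)) c≈1)

  α-odd⇒order≡4 : ¬ 2 ∣ α → 2 < m → ∀ {k} → IsOrder c k → k ≡ 4
  α-odd⇒order≡4 2∤α 2<m {k} order@(_ , c^k≈1 , _) with order≡1⊎2⊎4 k order c^4≈1
  ... | inj₁ refl        = contradiction (≈-trans (*-congˡ c c^k≈1) c^k≈1) (α-odd∧2<m⇒c^2≉1 2∤α 2<m)
  ... | inj₂ (inj₁ refl) = contradiction c^k≈1 (α-odd∧2<m⇒c^2≉1 2∤α 2<m)
  ... | inj₂ (inj₂ refl) = refl

  order-case : OddInt K → ∀ {k} → IsOrder c k → OrderCase α k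
  order-case K-odd {k} order@(_ , c^k≈1 , least) with order≡1⊎2⊎4 k order c^4≈1
  ... | inj₁ refl        =
    order-1 λ 4∣α → 4∣α⇒c≉1 K-odd 4∣α (≈-trans (≈-reflexive (sym (ℤ.^-identityʳ c))) c^k≈1)
  ... | inj₂ (inj₁ refl) =
    order-2 (decidable-stable (2 ∣? α) λ 2∤α → contradiction (least 1 (s≤s z≤n) (c^1≈1 2∤α)) λ { (s≤s ()) })
    where
    c^1≈1 : ¬ 2 ∣ α → c ^ 1 ≈ 1ℤ
    c^1≈1 2∤α = ≈-trans (≈-reflexive (ℤ.^-identityʳ c))
      (m∣2⇒x*x≈1⇒x≈1 (α-odd∧c^2≈1⇒m∣2 2∤α c^k≈1) (≈-trans (≈-reflexive (sym c^2≡c*c)) c^k≈1))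
  ... | inj₂ (inj₂ refl) =
    order-4 λ 2∣α → contradiction (least 2 (s≤s z≤n) (α-even⇒c^2≈1 2∣α)) λ { (s≤s (s≤s ())) }

theorem4p26 : (K : ℤ) → (m p a : ℕ) → OddInt K → 1 < m →
    IsPi K m p → IsAlpha K m a →
    ((3 < m → (countZeros K m p ≡ 4 ⇔ (a % 4 ≡ 1 ⊎ a % 4 ≡ 3)))
    × (countZeros K m p ≡ 2 ⇔ (4 ∣ p × 2 ∣ a))
    × (countZeros K m p ≡ 1 ⇔ (¬ (4 ∣ p))))
theorem4p26 K m p zero _ _ _ (() , _)
theorem4p26 K m p (suc a′) K-odd _ π-def α-def
  with k , refl , order ← RankOfApparition.π≡order*α K m a′ α-def π-def
  rewrite RankOfApparition.countZeros[k*α]≡k K m a′ α-def k =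
  let open RankOfApparition K m a′ α-def
      case = order-case K-odd order
  in (λ 3<m → k≡4⇔a%4≡1⊎a%4≡3 case (λ 2∤α → α-odd⇒order≡4 2∤α (ℕ.<⇒≤ 3<m) order))
   , k≡2⇔4∣k*a×2∣a case
   , k≡1⇔4∤k*a case
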